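{- Let $T$ be a text of length $n$, let $p^+_1<p^+_2<\dots<p^+_r<p^+_{r+1}=n+1$ be defined by $\{p^+_1,\dots,p^+_r,p^+_{r+1}\}=\{SA[l_1],\dots,SA[l_r],n+1\}$, and let $\delta^+$ be the permutation of $[1,r]$ satisfying $\phi(p^+_{\delta^+[1]})<\phi(p^+_{\delta^+[2]})<\dots<\phi(p^+_{\delta^+[r]})$. Then: (i) for $i\in[1,n]$ and $x$ the integer with $p^+_x\le i<p^+_{x+1}$, $\phi(i)=\phi(p^+_x)+(i-p^+_x)$; (ii) $\phi(p^+_{\delta^+[1]})=1$, and for every $i\in[2,r]$, $\phi(p^+_{\delta^+[i]})=\phi(p^+_{\delta^+[i-1]})+d$ where $d=p^+_{\delta^+[i-1]+1}-p^+_{\delta^+[i-1]}$; (iii) $p^+_1=1$.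
   Context: $T=T[1]\cdots T[n]$ is a string over an ordered alphabet whose last character $T[n]=\$$ is lexicographically smaller than every other character and occurs only at position $n$. $SA$ is the suffix array of $T$. The BWT $L$ of $T$ has $L[i]=T[SA[i]-1]$ (and $L[i]=T[n]$ if $SA[i]=1$). $L$ is partitioned into $r$ maximal runs of equal characters, and $l_j$ is the starting position of the $j$-th run. The function $\phi:[1,n]\to[1,n]$ is defined by $\phi(i)=SA[k-1]$ where $SA[k]=i$, with $\phi(i)=SA[n]$ if $i=SA[1]$. -}

module Defs where

open import Data.Nat using (ℕ; zero; suc; _+_; _∸_; _≤_; _<_; _≟_)
open import Data.Bool using (Bool; true; false; if_then_else_)
open import Data.List using (List; []; _∷_; length; drop)
open import Data.Sum using (_⊎_)
open import Data.Product using (_×_; Σ; ∃-syntax)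
open import Relation.Nullary using (¬_; yes; no)
open import Relation.Nullary.Decidable using (⌊_⌋)
open import Relation.Binary.PropositionalEquality using (_≡_)
open import Data.List.Relation.Binary.Lex.Strict using (Lex-<)

-- Characters are natural numbers with their usual order (an ordered alphabet).
-- Positions are 1-based natural numbers.

-- T[i] (1-based); out-of-range positions give 0 (never used).
at : List ℕ → ℕ → ℕ
at []       _             = 0
at (x ∷ xs) zero          = 0
at (x ∷ xs) (suc zero)    = x
at (x ∷ xs) (suc (suc i)) = at xs (suc i)

suffix : List ℕ → ℕ → List ℕ
suffix T i = drop (i ∸ 1) T

_<lex_ : List ℕ → List ℕ → Set
_<lex_ = Lex-< _≡_ _<_

ValidText : List ℕ → Set
ValidText T = 1 ≤ length T ×
  (∀ i → 1 ≤ i → i < length T → at T (length T) < at T i)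

IsSuffixArray : List ℕ → (ℕ → ℕ) → Set
IsSuffixArray T SA =
  (∀ k → 1 ≤ k → k ≤ length T → 1 ≤ SA k × SA k ≤ length T) ×
  (∀ k k' → 1 ≤ k → k ≤ length T → 1 ≤ k' → k' ≤ length T →
      SA k ≡ SA k' → k ≡ k') ×
  (∀ i → 1 ≤ i → i ≤ length T → ∃[ k ] (1 ≤ k × k ≤ length T × SA k ≡ i)) ×
  (∀ k → 1 ≤ k → k < length T → suffix T (SA k) <lex suffix T (SA (suc k)))

bwt : List ℕ → (ℕ → ℕ) → ℕ → ℕ
bwt T SA i with SA i
... | zero        = at T (length T)
... | suc zero    = at T (length T)
... | suc (suc j) = at T (suc j)

IsRunStart : List ℕ → (ℕ → ℕ) → ℕ → Set
IsRunStart T SA i = 1 ≤ i × i ≤ length T × (i ≡ 1 ⊎ ¬ (bwt T SA i ≡ bwt T SA (i ∸ 1)))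

isRunStartᵇ : List ℕ → (ℕ → ℕ) → ℕ → Bool
isRunStartᵇ T SA zero          = false
isRunStartᵇ T SA (suc zero)    = true
isRunStartᵇ T SA (suc (suc j)) = if ⌊ bwt T SA (suc (suc j)) ≟ bwt T SA (suc j) ⌋ then false else true

countRuns : List ℕ → (ℕ → ℕ) → ℕ → ℕ
countRuns T SA zero    = 0
countRuns T SA (suc m) = (if isRunStartᵇ T SA (suc m) then 1 else 0) + countRuns T SA m

runs : List ℕ → (ℕ → ℕ) → ℕ
runs T SA = countRuns T SA (length T)

invSearch : (ℕ → ℕ) → ℕ → ℕ → ℕ
invSearch SA zero    i = 0
invSearch SA (suc m) i with SA (suc m) ≟ i
... | yes _ = suc m
... | no  _ = invSearch SA m i

isa : List ℕ → (ℕ → ℕ) → ℕ → ℕ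
isa T SA i = invSearch SA (length T) i

phi : List ℕ → (ℕ → ℕ) → ℕ → ℕ
phi T SA i with isa T SA i
... | zero        = SA (length T)
... | suc zero    = SA (length T)
... | suc (suc k) = SA (suc k)

-- When L[k] = L[k-1] and k > 1, the suffixes starting one position
-- earlier, at SA[k] - 1 and SA[k-1] - 1, share their first character and are then ordered like
-- SA[k] and SA[k-1], with nothing in between: they are neighbours in SA too (the LF property),
-- so φ(i + 1) = φ(i) + 1 for every i + 1 that is not one of the p⁺_x. Hence φ shifts each block
-- [p⁺_x, p⁺_{x+1}) onto an interval of the same length. As φ is a bijection of [1, n], these
-- intervals tile [1, n], so listed by their left ends φ(p⁺_{δ⁺[i]}) they start at 1 and follow
-- each other without gaps. Finally the row of SA holding position 1 has L = $, which differs
-- from the row above it, so it starts a run and p⁺_1 = 1.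

module Submission where

open import Defs
open import Data.Nat using (ℕ; zero; suc; _+_; _∸_; _≤_; _<_; _≟_; _≤?_; z≤n; s≤s)
open import Data.Nat.Properties
open import Data.List using (List; []; _∷_; length; drop)
open import Data.List.Properties using (drop-all)
open import Data.List.Relation.Binary.Lex.Strict as Lex using (this; next; xs≮[])
import Data.List.Relation.Binary.Pointwise as Pointwise
open import Data.Product using (_×_; _,_; proj₁; proj₂; ∃-syntax)
open import Data.Sum using (_⊎_; inj₁; inj₂; [_,_]′)
open import Data.Empty using (⊥; ⊥-elim)
open import Relation.Nullary using (¬_; yes; no)
open import Relation.Binary.Structures using (IsStrictPartialOrder)
open import Relation.Binary.Definitions using (tri<; tri≈; tri>)
open import Relation.Binary.PropositionalEquality
open import Function using (_∘_)

private
  module <lex = IsStrictPartialOrder (Lex.<-isStrictPartialOrder <-isStrictPartialOrder)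

<lex-trans : ∀ {xs ys zs} → xs <lex ys → ys <lex zs → xs <lex zs
<lex-trans = <lex.trans

<lex-irrefl : ∀ xs → ¬ xs <lex xs
<lex-irrefl xs = <lex.irrefl (Pointwise.refl refl)

∷-<lex-between : ∀ {c t X Y Z} → (c ∷ X) <lex (t ∷ Y) → (t ∷ Y) <lex (c ∷ Z) →
  c ≡ t × X <lex Y × Y <lex Z
∷-<lex-between (this c<t)    (this t<c)    = ⊥-elim (<-asym c<t t<c)
∷-<lex-between (this c<c)    (next refl _) = ⊥-elim (<-irrefl refl c<c)
∷-<lex-between (next refl _) (this c<c)    = ⊥-elim (<-irrefl refl c<c)
∷-<lex-between (next refl X<Y) (next refl Y<Z) = refl , X<Y , Y<Z

drop≡at∷drop : ∀ (xs : List ℕ) j → suc j ≤ length xs → drop j xs ≡ at xs (suc j) ∷ drop (suc j) xs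
drop≡at∷drop (x ∷ xs) zero    _         = refl
drop≡at∷drop (x ∷ xs) (suc j) (s≤s j<n) = drop≡at∷drop xs j j<n

suffix≡at∷suffix : ∀ T i → 1 ≤ i → i ≤ length T → suffix T i ≡ at T i ∷ suffix T (suc i)
suffix≡at∷suffix T (suc i) _ i<n = drop≡at∷drop T i i<n

suffix-beyond : ∀ T i → length T < i → suffix T i ≡ []
suffix-beyond T (suc i) (s≤s n≤i) = drop-all i T n≤i

bwt-SA≡1 : ∀ T SA {k} → SA k ≡ 1 → bwt T SA k ≡ at T (length T)
bwt-SA≡1 T SA e rewrite e = refl

bwt-SA≡2+ : ∀ T SA {k u} → SA k ≡ suc (suc u) → bwt T SA k ≡ at T (suc u)
bwt-SA≡2+ T SA e rewrite e = refl

phi-rank≡1 : ∀ T SA {i} → isa T SA i ≡ 1 → phi T SA i ≡ SA (length T)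
phi-rank≡1 T SA e rewrite e = refl

phi-rank≡2+ : ∀ T SA {i k} → isa T SA i ≡ suc (suc k) → phi T SA i ≡ SA (suc k)
phi-rank≡2+ T SA e rewrite e = refl

isRunStart-or-bwt-repeats : ∀ T SA k → 1 ≤ k → k ≤ length T →
  IsRunStart T SA k ⊎ ∃[ c ] (k ≡ suc c × 1 ≤ c × bwt T SA (suc c) ≡ bwt T SA c)
isRunStart-or-bwt-repeats T SA (suc zero)    _ k≤n = inj₁ (s≤s z≤n , k≤n , inj₁ refl)
isRunStart-or-bwt-repeats T SA (suc (suc c)) _ k≤n with bwt T SA (suc (suc c)) ≟ bwt T SA (suc c)
... | yes e = inj₂ (suc c , refl , s≤s z≤n , e)
... | no ne = inj₁ (s≤s z≤n , k≤n , inj₂ ne)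

module SuffixArrayProperties (T : List ℕ) (SA : ℕ → ℕ) (valid : ValidText T) (isSA : IsSuffixArray T SA) where

  n : ℕ
  n = length T

  1≤n : 1 ≤ n
  1≤n = proj₁ valid

  sentinel-least : ∀ i → 1 ≤ i → i < n → at T n < at T i
  sentinel-least = proj₂ valid

  SA-range : ∀ k → 1 ≤ k → k ≤ n → 1 ≤ SA k × SA k ≤ n
  SA-range = proj₁ isSA

  SA-injective : ∀ k k' → 1 ≤ k → k ≤ n → 1 ≤ k' → k' ≤ n → SA k ≡ SA k' → k ≡ k'
  SA-injective = proj₁ (proj₂ isSA)

  SA-surjective : ∀ i → 1 ≤ i → i ≤ n → ∃[ k ] (1 ≤ k × k ≤ n × SA k ≡ i)
  SA-surjective = proj₁ (proj₂ (proj₂ isSA))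

  SA-sorted : ∀ k k' → 1 ≤ k → k < k' → k' ≤ n → suffix T (SA k) <lex suffix T (SA k')
  SA-sorted k (suc k') 1≤k (s≤s k≤k') k'<n with m≤n⇒m<n∨m≡n k≤k'
  ... | inj₂ refl = proj₂ (proj₂ (proj₂ isSA)) k 1≤k k'<n
  ... | inj₁ k<k' = <lex-trans (SA-sorted k k' 1≤k k<k' (<⇒≤ k'<n))
                               (proj₂ (proj₂ (proj₂ isSA)) k' (≤-trans 1≤k k≤k') k'<n)

  SA-<lex⇒< : ∀ k k' → 1 ≤ k → k ≤ n → 1 ≤ k' → k' ≤ n →
    suffix T (SA k) <lex suffix T (SA k') → k < k'
  SA-<lex⇒< k k' 1≤k k≤n 1≤k' k'≤n lt with <-cmp k k'
  ... | tri< k<k' _ _ = k<k'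
  ... | tri≈ _ refl _ = ⊥-elim (<lex-irrefl _ lt)
  ... | tri> _ _ k'<k = ⊥-elim (<lex-irrefl _ (<lex-trans lt (SA-sorted k' k 1≤k' k'<k k≤n)))

  rank : ℕ → ℕ
  rank = isa T SA

  private
    invSearch-SA : ∀ m k → 1 ≤ k → k ≤ m → m ≤ n → invSearch SA m (SA k) ≡ k
    invSearch-SA zero    zero    ()  _   _
    invSearch-SA zero    (suc k) _   ()  _
    invSearch-SA (suc m) k 1≤k k≤m m≤n with SA (suc m) ≟ SA k
    ... | yes e = SA-injective (suc m) k (s≤s z≤n) m≤n 1≤k (≤-trans k≤m m≤n) e
    ... | no ne with m≤n⇒m<n∨m≡n k≤m
    ... | inj₂ refl = ⊥-elim (ne refl)
    ... | inj₁ (s≤s k≤m') = invSearch-SA m k 1≤k k≤m' (≤-trans (n≤1+n m) m≤n)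

  rank-SA : ∀ k → 1 ≤ k → k ≤ n → rank (SA k) ≡ k
  rank-SA k 1≤k k≤n = invSearch-SA n k 1≤k k≤n ≤-refl

  SA-rank : ∀ i → 1 ≤ i → i ≤ n → SA (rank i) ≡ i
  SA-rank i 1≤i i≤n with SA-surjective i 1≤i i≤n
  ... | k , 1≤k , k≤n , refl = cong SA (rank-SA k 1≤k k≤n)

  rank-range : ∀ i → 1 ≤ i → i ≤ n → 1 ≤ rank i × rank i ≤ n
  rank-range i 1≤i i≤n with SA-surjective i 1≤i i≤n
  ... | k , 1≤k , k≤n , refl rewrite rank-SA k 1≤k k≤n = 1≤k , k≤n

  φ : ℕ → ℕ
  φ = phi T SA

  phi-SA-1 : φ (SA 1) ≡ SA n
  phi-SA-1 = phi-rank≡1 T SA (rank-SA 1 ≤-refl 1≤n)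

  phi-SA-suc : ∀ c → 1 ≤ c → suc c ≤ n → φ (SA (suc c)) ≡ SA c
  phi-SA-suc (suc c) _ c<n = phi-rank≡2+ T SA (rank-SA (suc (suc c)) (s≤s z≤n) c<n)

  phi-range : ∀ i → 1 ≤ i → i ≤ n → 1 ≤ φ i × φ i ≤ n
  phi-range i 1≤i i≤n with SA-surjective i 1≤i i≤n
  ... | suc zero , _ , _ , refl rewrite phi-SA-1 = SA-range n 1≤n ≤-refl
  ... | suc (suc c) , _ , k≤n , refl rewrite phi-SA-suc (suc c) (s≤s z≤n) k≤n =
    SA-range (suc c) (s≤s z≤n) (<⇒≤ k≤n)

  private
    SA-last≢ : ∀ c → suc (suc c) ≤ n → SA n ≢ SA (suc c)
    SA-last≢ c c<n e = <-irrefl (sym (SA-injective n (suc c) 1≤n ≤-refl (s≤s z≤n) (<⇒≤ c<n) e)) c<n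

  phi-injective : ∀ i j → 1 ≤ i → i ≤ n → 1 ≤ j → j ≤ n → φ i ≡ φ j → i ≡ j
  phi-injective i j 1≤i i≤n 1≤j j≤n e with SA-surjective i 1≤i i≤n | SA-surjective j 1≤j j≤n
  ... | suc zero , _ , _ , refl | suc zero , _ , _ , refl = refl
  ... | suc zero , _ , _ , refl | suc (suc c) , _ , c<n , refl =
    ⊥-elim (SA-last≢ c c<n (trans (sym phi-SA-1) (trans e (phi-SA-suc (suc c) (s≤s z≤n) c<n))))
  ... | suc (suc c) , _ , c<n , refl | suc zero , _ , _ , refl =
    ⊥-elim (SA-last≢ c c<n (trans (sym phi-SA-1) (trans (sym e) (phi-SA-suc (suc c) (s≤s z≤n) c<n))))
  ... | suc (suc c) , _ , c<n , refl | suc (suc c') , _ , c'<n , refl =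
    cong (SA ∘ suc) (SA-injective (suc c) (suc c') (s≤s z≤n) (<⇒≤ c<n) (s≤s z≤n) (<⇒≤ c'<n)
      (trans (sym (phi-SA-suc (suc c) (s≤s z≤n) c<n)) (trans e (phi-SA-suc (suc c') (s≤s z≤n) c'<n))))

  phi-surjective : ∀ v → 1 ≤ v → v ≤ n → ∃[ w ] (1 ≤ w × w ≤ n × φ w ≡ v)
  phi-surjective v 1≤v v≤n with SA-surjective v 1≤v v≤n
  ... | k , 1≤k , k≤n , refl with m≤n⇒m<n∨m≡n k≤n
  ... | inj₂ refl = SA 1 , proj₁ (SA-range 1 ≤-refl 1≤n) , proj₂ (SA-range 1 ≤-refl 1≤n) , phi-SA-1
  ... | inj₁ k<n =
    SA (suc k) , proj₁ (SA-range (suc k) (s≤s z≤n) k<n) , proj₂ (SA-range (suc k) (s≤s z≤n) k<n) ,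
    phi-SA-suc k 1≤k k<n

  SA≢1⇒SA≡2+ : ∀ k → 1 ≤ k → k ≤ n → SA k ≢ 1 → ∃[ u ] (SA k ≡ suc (suc u))
  SA≢1⇒SA≡2+ k 1≤k k≤n SAk≢1 with SA k | SA-range k 1≤k k≤n
  ... | suc zero    | _ = ⊥-elim (SAk≢1 refl)
  ... | suc (suc u) | _ = u , refl

  sentinel<bwt : ∀ k → 1 ≤ k → k ≤ n → SA k ≢ 1 → at T n < bwt T SA k
  sentinel<bwt k 1≤k k≤n SAk≢1 with SA≢1⇒SA≡2+ k 1≤k k≤n SAk≢1
  ... | u , SAk≡ = subst (at T n <_) (sym (bwt-SA≡2+ T SA SAk≡))
    (sentinel-least (suc u) (s≤s z≤n) (subst (_≤ n) SAk≡ (proj₂ (SA-range k 1≤k k≤n))))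

  bwt-repeat⇒SA≢1 : ∀ c → 1 ≤ c → suc c ≤ n → bwt T SA (suc c) ≡ bwt T SA c →
    SA c ≢ 1 × SA (suc c) ≢ 1
  bwt-repeat⇒SA≢1 c 1≤c c<n repeat = SAc≢1 , SAc+1≢1
    where
      SA-distinct : SA c ≢ SA (suc c)
      SA-distinct e = <-irrefl (SA-injective c (suc c) 1≤c (<⇒≤ c<n) (s≤s z≤n) c<n e) (n<1+n c)
      SAc≢1 : SA c ≢ 1
      SAc≢1 e = <-irrefl (trans (sym (bwt-SA≡1 T SA e)) (sym repeat))
                  (sentinel<bwt (suc c) (s≤s z≤n) c<n (λ e' → SA-distinct (trans e (sym e'))))
      SAc+1≢1 : SA (suc c) ≢ 1
      SAc+1≢1 e = <-irrefl (trans (sym (bwt-SA≡1 T SA e)) repeat)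
                    (sentinel<bwt c 1≤c (<⇒≤ c<n) (λ e' → SA-distinct (trans e' (sym e))))

  <lex⇒rank< : ∀ i j → 1 ≤ i → i ≤ n → 1 ≤ j → j ≤ n →
    suffix T i <lex suffix T j → rank i < rank j
  <lex⇒rank< i j 1≤i i≤n 1≤j j≤n lt =
    SA-<lex⇒< (rank i) (rank j) (proj₁ (rank-range i 1≤i i≤n)) (proj₂ (rank-range i 1≤i i≤n))
      (proj₁ (rank-range j 1≤j j≤n)) (proj₂ (rank-range j 1≤j j≤n))
      (subst₂ (λ x y → suffix T x <lex suffix T y) (sym (SA-rank i 1≤i i≤n)) (sym (SA-rank j 1≤j j≤n)) lt)

  no-suffix-between-neighbours : ∀ c w → 1 ≤ c → suc c ≤ n → 1 ≤ w →
    suffix T (SA c) <lex suffix T w → suffix T w <lex suffix T (SA (suc c)) → ⊥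
  no-suffix-between-neighbours c w 1≤c c<n 1≤w above below with w ≤? n
  ... | no w≰n = xs≮[] (subst (suffix T (SA c) <lex_) (suffix-beyond T w (≰⇒> w≰n)) above)
  ... | yes w≤n = <⇒≱ c<k (≤-pred k<c+1)
    where
      k = rank w
      1≤k = proj₁ (rank-range w 1≤w w≤n)
      k≤n = proj₂ (rank-range w 1≤w w≤n)
      SAk≡w = SA-rank w 1≤w w≤n
      c<k : c < k
      c<k = SA-<lex⇒< c k 1≤c (<⇒≤ c<n) 1≤k k≤n
              (subst (λ x → suffix T (SA c) <lex suffix T x) (sym SAk≡w) above)
      k<c+1 : k < suc c
      k<c+1 = SA-<lex⇒< k (suc c) 1≤k k≤n (s≤s z≤n) c<n
                (subst (λ x → suffix T x <lex suffix T (SA (suc c))) (sym SAk≡w) below)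

  -- The LF property: prepending one common character keeps two suffixes adjacent in SA.
  rank-adjacent : ∀ c u v → 1 ≤ c → suc c ≤ n → SA c ≡ suc u → SA (suc c) ≡ suc v →
    1 ≤ u → 1 ≤ v → at T u ≡ at T v → rank v ≡ suc (rank u)
  rank-adjacent c u v 1≤c c<n SAc≡ SAc+1≡ 1≤u 1≤v same-head = sym (≤-antisym a<b b≤a+1)
    where
      u<n : u < n
      u<n = subst (_≤ n) SAc≡ (proj₂ (SA-range c 1≤c (<⇒≤ c<n)))
      v<n : v < n
      v<n = subst (_≤ n) SAc+1≡ (proj₂ (SA-range (suc c) (s≤s z≤n) c<n))
      a = rank u
      b = rank v
      SAa≡u = SA-rank u 1≤u (<⇒≤ u<n)
      SAb≡v = SA-rank v 1≤v (<⇒≤ v<n)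
      tails : suffix T (suc u) <lex suffix T (suc v)
      tails = subst₂ (λ x y → suffix T x <lex suffix T y) SAc≡ SAc+1≡ (SA-sorted c (suc c) 1≤c ≤-refl c<n)
      suffix-u : suffix T u ≡ at T u ∷ suffix T (suc u)
      suffix-u = suffix≡at∷suffix T u 1≤u (<⇒≤ u<n)
      suffix-v : suffix T v ≡ at T u ∷ suffix T (suc v)
      suffix-v = trans (suffix≡at∷suffix T v 1≤v (<⇒≤ v<n)) (cong (_∷ suffix T (suc v)) (sym same-head))
      a<b : a < b
      a<b = <lex⇒rank< u v 1≤u (<⇒≤ u<n) 1≤v (<⇒≤ v<n)
              (subst₂ _<lex_ (sym suffix-u) (sym suffix-v) (next refl tails))
      b≤a+1 : b ≤ suc a
      b≤a+1 = ≮⇒≥ λ a+1<b →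
        let m = SA (suc a)
            a+1≤n = ≤-trans (<⇒≤ a+1<b) (proj₂ (rank-range v 1≤v (<⇒≤ v<n)))
            1≤m = proj₁ (SA-range (suc a) (s≤s z≤n) a+1≤n)
            m≤n = proj₂ (SA-range (suc a) (s≤s z≤n) a+1≤n)
            suffix-m = suffix≡at∷suffix T m 1≤m m≤n
            u<m = subst (λ x → suffix T x <lex suffix T m) SAa≡u
                    (SA-sorted a (suc a) (proj₁ (rank-range u 1≤u (<⇒≤ u<n))) ≤-refl a+1≤n)
            m<v = subst (λ x → suffix T m <lex suffix T x) SAb≡v
                    (SA-sorted (suc a) b (s≤s z≤n) a+1<b (proj₂ (rank-range v 1≤v (<⇒≤ v<n))))
            _ , u<m′ , m<v′ = ∷-<lex-between (subst₂ _<lex_ suffix-u suffix-m u<m)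
                                             (subst₂ _<lex_ suffix-m suffix-v m<v)
        in no-suffix-between-neighbours c (suc m) 1≤c c<n (s≤s z≤n)
             (subst (λ x → suffix T x <lex suffix T (suc m)) (sym SAc≡) u<m′)
             (subst (λ x → suffix T (suc m) <lex suffix T x) (sym SAc+1≡) m<v′)

  phi-suc-of-bwt-repeat : ∀ c → 1 ≤ c → suc c ≤ n → bwt T SA (suc c) ≡ bwt T SA c →
    ∃[ v ] (SA (suc c) ≡ suc v × 1 ≤ v × φ (suc v) ≡ suc (φ v))
  phi-suc-of-bwt-repeat c 1≤c c<n repeat
    with SA≢1⇒SA≡2+ c 1≤c (<⇒≤ c<n) (proj₁ (bwt-repeat⇒SA≢1 c 1≤c c<n repeat))
       | SA≢1⇒SA≡2+ (suc c) (s≤s z≤n) c<n (proj₂ (bwt-repeat⇒SA≢1 c 1≤c c<n repeat))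
  ... | u , SAc≡ | v , SAc+1≡ = suc v , SAc+1≡ , s≤s z≤n , step
    where
      same-head : at T (suc u) ≡ at T (suc v)
      same-head = trans (sym (bwt-SA≡2+ T SA SAc≡)) (trans (sym repeat) (bwt-SA≡2+ T SA SAc+1≡))
      adjacent : rank (suc v) ≡ suc (rank (suc u))
      adjacent = rank-adjacent c (suc u) (suc v) 1≤c c<n SAc≡ SAc+1≡ (s≤s z≤n) (s≤s z≤n) same-head
      u<n : suc u ≤ n
      u<n = <⇒≤ (subst (_≤ n) SAc≡ (proj₂ (SA-range c 1≤c (<⇒≤ c<n))))
      v<n : suc v ≤ n
      v<n = <⇒≤ (subst (_≤ n) SAc+1≡ (proj₂ (SA-range (suc c) (s≤s z≤n) c<n)))
      1≤a : 1 ≤ rank (suc u)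
      1≤a = proj₁ (rank-range (suc u) (s≤s z≤n) u<n)
      a+1≤n : suc (rank (suc u)) ≤ n
      a+1≤n = subst (_≤ n) adjacent (proj₂ (rank-range (suc v) (s≤s z≤n) v<n))
      step : φ (suc (suc v)) ≡ suc (φ (suc v))
      step = begin
        φ (suc (suc v))                  ≡⟨ cong φ (sym SAc+1≡) ⟩
        φ (SA (suc c))                   ≡⟨ phi-SA-suc c 1≤c c<n ⟩
        SA c                             ≡⟨ SAc≡ ⟩
        suc (suc u)                      ≡⟨ cong suc (sym (SA-rank (suc u) (s≤s z≤n) u<n)) ⟩
        suc (SA (rank (suc u)))          ≡⟨ cong suc (sym (phi-SA-suc (rank (suc u)) 1≤a a+1≤n)) ⟩
        suc (φ (SA (suc (rank (suc u))))) ≡⟨ cong (λ k → suc (φ (SA k))) (sym adjacent) ⟩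
        suc (φ (SA (rank (suc v))))      ≡⟨ cong (suc ∘ φ) (SA-rank (suc v) (s≤s z≤n) v<n) ⟩
        suc (φ (suc v))                  ∎
        where open ≡-Reasoning

module BlockDecomposition (T : List ℕ) (SA : ℕ → ℕ) (valid : ValidText T) (isSA : IsSuffixArray T SA)
    (p : ℕ → ℕ)
    (p-mono : ∀ x y → 1 ≤ x → x < y → y ≤ suc (runs T SA) → p x < p y)
    (p-last : p (suc (runs T SA)) ≡ suc (length T))
    (p-runStart : ∀ x → 1 ≤ x → x ≤ runs T SA → ∃[ j ] (IsRunStart T SA j × SA j ≡ p x))
    (runStart-p : ∀ j → IsRunStart T SA j → ∃[ x ] (1 ≤ x × x ≤ runs T SA × p x ≡ SA j))
  where

  open SuffixArrayProperties T SA valid isSA public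

  r : ℕ
  r = runs T SA

  IsBoundary : ℕ → Set
  IsBoundary w = ∃[ x ] (1 ≤ x × x ≤ r × p x ≡ w)

  p-range : ∀ x → 1 ≤ x → x ≤ r → 1 ≤ p x × p x ≤ n
  p-range x 1≤x x≤r with p-runStart x 1≤x x≤r
  ... | j , (1≤j , j≤n , _) , SAj≡px = subst (λ w → 1 ≤ w × w ≤ n) SAj≡px (SA-range j 1≤j j≤n)

  p-mono≤ : ∀ x y → 1 ≤ x → x ≤ y → y ≤ suc r → p x ≤ p y
  p-mono≤ x y 1≤x x≤y y≤r+1 with m≤n⇒m<n∨m≡n x≤y
  ... | inj₁ x<y  = <⇒≤ (p-mono x y 1≤x x<y y≤r+1)
  ... | inj₂ refl = ≤-refl

  block-end : ∀ y → 1 ≤ y → y ≤ r → ∃[ d ] (p y + suc d ≡ p (suc y))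
  block-end y 1≤y y≤r with m≤n⇒∃[o]m+o≡n (p-mono y (suc y) 1≤y ≤-refl (s≤s y≤r))
  ... | d , py+1+d≡ = d , trans (+-suc (p y) d) py+1+d≡

  inside-block⇒≤n : ∀ x w → x ≤ r → w < p (suc x) → w ≤ n
  inside-block⇒≤n x w x≤r w<next =
    ≤-pred (≤-trans w<next
      (subst (p (suc x) ≤_) p-last (p-mono≤ (suc x) (suc r) (s≤s z≤n) (s≤s x≤r) ≤-refl)))

  next-isBoundary-or-end : ∀ y → y ≤ r → IsBoundary (p (suc y)) ⊎ p (suc y) ≡ suc n
  next-isBoundary-or-end y y≤r with suc y ≤? r
  ... | yes y<r = inj₁ (suc y , s≤s z≤n , y<r , refl)
  ... | no  y≮r =
    inj₂ (subst (λ z → p (suc z) ≡ suc n) (sym (≤-antisym y≤r (≤-pred (≰⇒> y≮r)))) p-last)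

  boundary-not-inside : ∀ x t → 1 ≤ x → x ≤ r → 0 < t → p x + t < p (suc x) → ¬ IsBoundary (p x + t)
  boundary-not-inside x t 1≤x x≤r 0<t inside (y , 1≤y , y≤r , py≡) with y ≤? x
  ... | yes y≤x = <⇒≱ (m<m+n (p x) 0<t)
                    (subst (_≤ p x) py≡ (p-mono≤ y x 1≤y y≤x (m≤n⇒m≤1+n x≤r)))
  ... | no  y≰x = <⇒≱ inside
                    (subst (p (suc x) ≤_) py≡
                      (p-mono≤ (suc x) y (s≤s z≤n) (≰⇒> y≰x) (m≤n⇒m≤1+n y≤r)))

  1-isBoundary : IsBoundary 1
  1-isBoundary with SA-surjective 1 ≤-refl 1≤n
  ... | k , 1≤k , k≤n , SAk≡1 with isRunStart-or-bwt-repeats T SA k 1≤k k≤n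
  ... | inj₁ start = subst IsBoundary SAk≡1 (runStart-p k start)
  ... | inj₂ (c , refl , 1≤c , repeat) = ⊥-elim (proj₂ (bwt-repeat⇒SA≢1 c 1≤c k≤n repeat) SAk≡1)

  1≤r : 1 ≤ r
  1≤r = ≤-trans (proj₁ (proj₂ 1-isBoundary)) (proj₁ (proj₂ (proj₂ 1-isBoundary)))

  p-first : p 1 ≡ 1
  p-first with 1-isBoundary
  ... | x , 1≤x , x≤r , px≡1 =
    ≤-antisym (subst (p 1 ≤_) px≡1 (p-mono≤ 1 x ≤-refl 1≤x (m≤n⇒m≤1+n x≤r)))
              (proj₁ (p-range 1 ≤-refl 1≤r))

  boundary-or-phi-suc : ∀ w → 1 ≤ w → w ≤ n →
    IsBoundary w ⊎ (¬ IsBoundary w × ∃[ w' ] (w ≡ suc w' × 1 ≤ w' × φ w ≡ suc (φ w')))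
  boundary-or-phi-suc w 1≤w w≤n with SA-surjective w 1≤w w≤n
  ... | k , 1≤k , k≤n , refl with isRunStart-or-bwt-repeats T SA k 1≤k k≤n
  ... | inj₁ start = inj₁ (runStart-p k start)
  ... | inj₂ (c , refl , 1≤c , repeat) with phi-suc-of-bwt-repeat c 1≤c k≤n repeat
  ... | v , SAk≡ , 1≤v , step =
    inj₂ (not-boundary , v , SAk≡ , 1≤v , subst (λ u → φ u ≡ suc (φ v)) (sym SAk≡) step)
    where
      not-boundary : ¬ IsBoundary (SA (suc c))
      not-boundary (y , 1≤y , y≤r , py≡) with p-runStart y 1≤y y≤r
      ... | j , (1≤j , j≤n , first-or-changes) , SAj≡py
          with SA-injective j (suc c) 1≤j j≤n 1≤k k≤n (trans SAj≡py py≡)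
      ... | refl with first-or-changes
      ... | inj₁ c+1≡1 = 1+n≰n (subst (1 ≤_) (suc-injective c+1≡1) 1≤c)
      ... | inj₂ changes = changes repeat

  phi-within-block : ∀ x t → 1 ≤ x → x ≤ r → p x + t < p (suc x) → φ (p x + t) ≡ φ (p x) + t
  phi-within-block x zero _ _ _ rewrite +-identityʳ (p x) | +-identityʳ (φ (p x)) = refl
  phi-within-block x (suc t) 1≤x x≤r inside
    with boundary-or-phi-suc (p x + suc t) (≤-trans (proj₁ (p-range x 1≤x x≤r)) (m≤m+n (p x) (suc t)))
                             (inside-block⇒≤n x (p x + suc t) x≤r inside)
  ... | inj₁ boundary = ⊥-elim (boundary-not-inside x (suc t) 1≤x x≤r (s≤s z≤n) inside boundary)
  ... | inj₂ (_ , w' , w≡ , _ , step) = begin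
      φ (p x + suc t)   ≡⟨ step ⟩
      suc (φ w')        ≡⟨ cong (suc ∘ φ) (suc-injective (trans (sym w≡) (+-suc (p x) t))) ⟩
      suc (φ (p x + t)) ≡⟨ cong suc (phi-within-block x t 1≤x x≤r
                              (<-trans (+-monoʳ-< (p x) (n<1+n t)) inside)) ⟩
      suc (φ (p x) + t) ≡⟨ sym (+-suc (φ (p x)) t) ⟩
      φ (p x) + suc t   ∎
    where open ≡-Reasoning

  phi-on-block : ∀ i x → 1 ≤ x → x ≤ r → p x ≤ i → i < p (suc x) → φ i ≡ φ (p x) + (i ∸ p x)
  phi-on-block i x 1≤x x≤r px≤i i<next =
    trans (cong φ (sym px+t≡i))
          (phi-within-block x (i ∸ p x) 1≤x x≤r (subst (_< p (suc x)) (sym px+t≡i) i<next))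
    where
      px+t≡i : p x + (i ∸ p x) ≡ i
      px+t≡i = m+[n∸m]≡n px≤i

  -- By injectivity of φ such a w is the last position of block y, so w + 1 = p(y + 1) is a
  -- boundary or n + 1.
  block-end-not-phi-suc : ∀ y d w → 1 ≤ y → y ≤ r → p y + suc d ≡ p (suc y) → 1 ≤ w → suc w ≤ n →
    ¬ IsBoundary (suc w) → suc (φ w) ≢ φ (p y) + suc d
  block-end-not-phi-suc y d w 1≤y y≤r end 1≤w w<n not-boundary φw+1≡ =
    [ (λ next-isBoundary → not-boundary (subst IsBoundary (sym w+1≡next) next-isBoundary))
    , (λ next≡n+1 → 1+n≰n (subst (_≤ n) (trans w+1≡next next≡n+1) w<n))
    ]′ (next-isBoundary-or-end y y≤r)
    where
      last : p y + d < p (suc y)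
      last = subst (p y + d <_) end (+-monoʳ-< (p y) (n<1+n d))
      w≡last : w ≡ p y + d
      w≡last = phi-injective w (p y + d) 1≤w (<⇒≤ w<n)
        (≤-trans (proj₁ (p-range y 1≤y y≤r)) (m≤m+n (p y) d)) (inside-block⇒≤n y (p y + d) y≤r last)
        (suc-injective (begin
          suc (φ w)             ≡⟨ φw+1≡ ⟩
          φ (p y) + suc d       ≡⟨ +-suc (φ (p y)) d ⟩
          suc (φ (p y) + d)     ≡⟨ cong suc (sym (phi-within-block y d 1≤y y≤r last)) ⟩
          suc (φ (p y + d))     ∎))
        where open ≡-Reasoning
      w+1≡next : suc w ≡ p (suc y)
      w+1≡next = trans (cong suc w≡last) (trans (sym (+-suc (p y) d)) end)

  module SortedByPhi
      (δ : ℕ → ℕ)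
      (δ-range : ∀ i → 1 ≤ i → i ≤ r → 1 ≤ δ i × δ i ≤ r)
      (δ-surjective : ∀ x → 1 ≤ x → x ≤ r → ∃[ i ] (1 ≤ i × i ≤ r × δ i ≡ x))
      (δ-sorted : ∀ i → 1 ≤ i → i < r → φ (p (δ i)) < φ (p (δ (suc i))))
    where

    s : ℕ → ℕ
    s i = φ (p (δ i))

    pδ-range : ∀ i → 1 ≤ i → i ≤ r → 1 ≤ p (δ i) × p (δ i) ≤ n
    pδ-range i 1≤i i≤r = p-range (δ i) (proj₁ (δ-range i 1≤i i≤r)) (proj₂ (δ-range i 1≤i i≤r))

    s-range : ∀ i → 1 ≤ i → i ≤ r → 1 ≤ s i × s i ≤ n
    s-range i 1≤i i≤r = phi-range (p (δ i)) (proj₁ (pδ-range i 1≤i i≤r)) (proj₂ (pδ-range i 1≤i i≤r))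

    s-mono : ∀ i j → 1 ≤ i → i < j → j ≤ r → s i < s j
    s-mono i (suc j) 1≤i (s≤s i≤j) j<r with m≤n⇒m<n∨m≡n i≤j
    ... | inj₂ refl = δ-sorted i 1≤i j<r
    ... | inj₁ i<j  = <-trans (s-mono i j 1≤i i<j (<⇒≤ j<r)) (δ-sorted j (≤-trans 1≤i i≤j) j<r)

    s-mono≤ : ∀ i j → 1 ≤ i → i ≤ j → j ≤ r → s i ≤ s j
    s-mono≤ i j 1≤i i≤j j≤r with m≤n⇒m<n∨m≡n i≤j
    ... | inj₁ i<j  = <⇒≤ (s-mono i j 1≤i i<j j≤r)
    ... | inj₂ refl = ≤-refl

    phi-preimage : ∀ v → 1 ≤ v → v ≤ n →
      ∃[ m ] (1 ≤ m × m ≤ r × s m ≡ v) ⊎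
      ∃[ w ] (1 ≤ w × suc w ≤ n × ¬ IsBoundary (suc w) × suc (φ w) ≡ v)
    phi-preimage v 1≤v v≤n with phi-surjective v 1≤v v≤n
    ... | w , 1≤w , w≤n , φw≡v with boundary-or-phi-suc w 1≤w w≤n
    ... | inj₂ (not-boundary , w' , refl , 1≤w' , step) =
      inj₂ (w' , 1≤w' , w≤n , not-boundary , trans (sym step) φw≡v)
    ... | inj₁ (x , 1≤x , x≤r , px≡w) with δ-surjective x 1≤x x≤r
    ... | m , 1≤m , m≤r , δm≡x =
      inj₁ (m , 1≤m , m≤r , trans (cong (φ ∘ p) δm≡x) (trans (cong φ px≡w) φw≡v))

    s-first : s 1 ≡ 1
    s-first with phi-preimage 1 ≤-refl 1≤n
    ... | inj₁ (m , 1≤m , m≤r , sm≡1) =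
      ≤-antisym (subst (s 1 ≤_) sm≡1 (s-mono≤ 1 m ≤-refl 1≤m m≤r)) (proj₁ (s-range 1 ≤-refl 1≤r))
    ... | inj₂ (w , 1≤w , w<n , _ , φw+1≡1) =
      ⊥-elim (1+n≰n (subst (1 ≤_) (suc-injective φw+1≡1) (proj₁ (phi-range w 1≤w (<⇒≤ w<n)))))

    s-step-≥ : ∀ i d → 1 ≤ i → suc i ≤ r → p (δ i) + suc d ≡ p (suc (δ i)) →
      s i + suc d ≤ s (suc i)
    -- Otherwise block δ i would contain p (δ (i + 1)), at offset s (i + 1) ∸ s i.
    s-step-≥ i d 1≤i i<r end =
      ≮⇒≥ λ S<v → boundary-not-inside y t 1≤y y≤r 0<t (inside S<v) (offset-isBoundary S<v)
      where
        y = δ i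
        1≤y = proj₁ (δ-range i 1≤i (<⇒≤ i<r))
        y≤r = proj₂ (δ-range i 1≤i (<⇒≤ i<r))
        si<S : s i < s (suc i)
        si<S = s-mono i (suc i) 1≤i ≤-refl i<r
        t = s (suc i) ∸ s i
        0<t : 0 < t
        0<t = m<n⇒0<n∸m si<S
        si+t≡S : s i + t ≡ s (suc i)
        si+t≡S = m+[n∸m]≡n (<⇒≤ si<S)
        inside : s (suc i) < s i + suc d → p y + t < p (suc y)
        inside S<v = subst (p y + t <_) end
          (+-monoʳ-< (p y) (+-cancelˡ-< (s i) t (suc d) (subst (_< s i + suc d) (sym si+t≡S) S<v)))
        offset-isBoundary : s (suc i) < s i + suc d → IsBoundary (p y + t)
        offset-isBoundary S<v =
          δ (suc i) , proj₁ (δ-range (suc i) (s≤s z≤n) i<r) , proj₂ (δ-range (suc i) (s≤s z≤n) i<r) ,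
          sym (phi-injective (p y + t) (p (δ (suc i)))
                (≤-trans (proj₁ (p-range y 1≤y y≤r)) (m≤m+n (p y) t))
                (inside-block⇒≤n y (p y + t) y≤r (inside S<v))
                (proj₁ (pδ-range (suc i) (s≤s z≤n) i<r)) (proj₂ (pδ-range (suc i) (s≤s z≤n) i<r))
                (trans (phi-within-block y t 1≤y y≤r (inside S<v)) si+t≡S))

    s-step-≤ : ∀ i d → 1 ≤ i → suc i ≤ r → p (δ i) + suc d ≡ p (suc (δ i)) →
      s (suc i) ≤ s i + suc d
    s-step-≤ i d 1≤i i<r end with phi-preimage (s i + suc d) 1≤v v≤n
      where
        1≤v : 1 ≤ s i + suc d
        1≤v = ≤-trans (s≤s z≤n) (m≤n+m (suc d) (s i))
        v≤n : s i + suc d ≤ n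
        v≤n = ≤-trans (s-step-≥ i d 1≤i i<r end) (proj₂ (s-range (suc i) (s≤s z≤n) i<r))
    ... | inj₁ (m , 1≤m , m≤r , sm≡v) =
      subst (s (suc i) ≤_) sm≡v (s-mono≤ (suc i) m (s≤s z≤n) (≰⇒> m≰i) m≤r)
      where
        m≰i : ¬ m ≤ i
        m≰i m≤i = <⇒≱ (m<m+n (s i) (s≤s z≤n))
                      (subst (_≤ s i) sm≡v (s-mono≤ m i 1≤m m≤i (<⇒≤ i<r)))
    ... | inj₂ (w , 1≤w , w<n , not-boundary , φw+1≡v) =
      ⊥-elim (block-end-not-phi-suc (δ i) d w
                (proj₁ (δ-range i 1≤i (<⇒≤ i<r))) (proj₂ (δ-range i 1≤i (<⇒≤ i<r)))
                end 1≤w w<n not-boundary φw+1≡v)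

    s-step : ∀ i → 1 ≤ i → suc i ≤ r → s (suc i) ≡ s i + (p (suc (δ i)) ∸ p (δ i))
    s-step i 1≤i i<r
      with block-end (δ i) (proj₁ (δ-range i 1≤i (<⇒≤ i<r))) (proj₂ (δ-range i 1≤i (<⇒≤ i<r)))
    ... | d , end = begin
      s (suc i)                           ≡⟨ ≤-antisym (s-step-≤ i d 1≤i i<r end) (s-step-≥ i d 1≤i i<r end) ⟩
      s i + suc d                         ≡⟨ cong (s i +_) (sym (m+n∸m≡n (p (δ i)) (suc d))) ⟩
      s i + (p (δ i) + suc d ∸ p (δ i))   ≡⟨ cong (λ b → s i + (b ∸ p (δ i))) end ⟩
      s i + (p (suc (δ i)) ∸ p (δ i))     ∎
      where open ≡-Reasoning

lemma3 : (T : List ℕ) (SA : ℕ → ℕ) → ValidText T → IsSuffixArray T SA →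
    (p : ℕ → ℕ) →
    (∀ x y → 1 ≤ x → x < y → y ≤ suc (runs T SA) → p x < p y) →
    p (suc (runs T SA)) ≡ suc (length T) →
    (∀ x → 1 ≤ x → x ≤ runs T SA → ∃[ j ] (IsRunStart T SA j × SA j ≡ p x)) →
    (∀ j → IsRunStart T SA j → ∃[ x ] (1 ≤ x × x ≤ runs T SA × p x ≡ SA j)) →
    (δ : ℕ → ℕ) →
    (∀ i → 1 ≤ i → i ≤ runs T SA → 1 ≤ δ i × δ i ≤ runs T SA) →
    (∀ i j → 1 ≤ i → i ≤ runs T SA → 1 ≤ j → j ≤ runs T SA → δ i ≡ δ j → i ≡ j) →
    (∀ x → 1 ≤ x → x ≤ runs T SA → ∃[ i ] (1 ≤ i × i ≤ runs T SA × δ i ≡ x)) →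
    (∀ i → 1 ≤ i → i < runs T SA → phi T SA (p (δ i)) < phi T SA (p (δ (suc i)))) →
    (∀ i x → 1 ≤ i → i ≤ length T → 1 ≤ x → x ≤ runs T SA → p x ≤ i → i < p (suc x) →
       phi T SA i ≡ phi T SA (p x) + (i ∸ p x))
    × (phi T SA (p (δ 1)) ≡ 1
       × (∀ i → 2 ≤ i → i ≤ runs T SA →
            phi T SA (p (δ i)) ≡ phi T SA (p (δ (i ∸ 1))) + (p (suc (δ (i ∸ 1))) ∸ p (δ (i ∸ 1)))))
    × p 1 ≡ 1
lemma3 T SA valid isSA p p-mono p-last p-runStart runStart-p δ δ-range _ δ-surjective δ-sorted =
  (λ i x _ _ → phi-on-block i x) , (s-first , λ { (suc i) (s≤s 1≤i) i<r → s-step i 1≤i i<r }) , p-first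
  where
    open BlockDecomposition T SA valid isSA p p-mono p-last p-runStart runStart-p
    open SortedByPhi δ δ-range δ-surjective δ-sorted
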